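{- Let $\mathcal{D}=(\mathrm{Col},\mathrm{T},\text{white})$ be a domino tiling system in which no tile has more than two white sides. If there exists a $\mathcal{D}$-snake, then $\mathcal{D}$ is solvable.
   Context: A domino tiling system is a triple $\mathcal{D}=(\mathrm{Col},\mathrm{T},\text{white})$, where $\mathrm{Col}$ is a finite set of colours, $\mathrm{T}\subseteq\mathrm{Col}^4$, and $\text{white}\in\mathrm{Col}$. A tile $(c_l,c_d,c_r,c_u)$ is: - left-border if $c_l=\text{white}$; - down-border if $c_d=\text{white}$; - right-border if $c_r=\text{white}$; - up-border if $c_u=\text{white}$. Tiles $t=(c_l,c_d,c_r,c_u)$ and $t'=(c_l',c_d',c_r',c_u')$ are H-compatible if $c_r=c_l'$, and V-compatible if $c_u=c_d'$. Let $\mathbb{Z}_n=\{0,\dots,n-1\}$. $\mathcal{D}$ covers $\mathbb{Z}_n\times\mathbb{Z}_m$ if there is $\xi:\mathbb{Z}_n\times\mathbb{Z}_m\to\mathrm{T}$ such that for all $(x,y)$ with $\xi(x,y)=(c_l,c_d,c_r,c_u)$: - $x=0$ iff $c_l=\text{white}$; $x=n-1$ iff $c_r=\text{white}$; $y=0$ iff $c_d=\text{white}$; $y=m-1$ iff $c_u=\text{white}$; - $\xi(x,y),\xi(x+1,y)$ are H-compatible whenever $x+1<n$; - $\xi(x,y),\xi(x,y+1)$ are V-compatible whenever $y+1<m$. $\mathcal{D}$ is solvable if it covers $\mathbb{Z}_n\times\mathbb{Z}_m$ for some positive integers $n,m$. Fix a role name $r$, concept names $C_t$ for $t\in\mathrm{T}$,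 and individual names $ld,rd,lu,ru$. In an interpretation $\mathcal{I}$: - an element $d$ carries $t$ if $d\in C_t^{\mathcal{I}}$; - an $r$-path is a sequence $\rho_1\cdots\rho_k$ of elements with $(\rho_j,\rho_{j+1})\in r^{\mathcal{I}}$ for all $j$; its length is $k-1$; - $e$ is $r^\ell$-reachable (resp. $r^+$-, $r^*$-reachable) from $d$ if some $r$-path of length $\ell$ (resp. positive, arbitrary length) goes from $d$ to $e$. $\mathcal{I}$ is a $\mathcal{D}$-snake if all of the following hold: (SPath) There is an $r$-path $\rho_1\cdots\rho_k$ and indices $1<i<j<k$ with $\rho_1=ld^{\mathcal{I}}$, $\rho_i=rd^{\mathcal{I}}$, $\rho_j=lu^{\mathcal{I}}$ and $\rho_k=ru^{\mathcal{I}}$. (SNoLoop) None of $ld^{\mathcal{I}},rd^{\mathcal{I}},lu^{\mathcal{I}},ru^{\mathcal{I}}$ is $r^+$-reachable from itself. (SUniqTil) Every element $r^*$-reachable from $ld^{\mathcal{I}}$ carries exactly one tile of $\mathrm{T}$. (SSpecTil) An element $r^*$-reachable from $ld^{\mathcal{I}}$ carries a tile with two white sides iff it is one of $ld^{\mathcal{I}},rd^{\mathcal{I}},lu^{\mathcal{I}},ru^{\mathcal{I}}$. Moreover: - $ld^{\mathcal{I}}$ carries a left- and down-border tile; - $rd^{\mathcal{I}}$ carries a right- and down-border tile; - $lu^{\mathcal{I}}$ carries a left- and up-border tile; - $ru^{\mathcal{I}}$ carries a right- and up-border tile. (SHori) Let $d\neq ru^{\mathcal{I}}$ be $r^*$-reachable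 from $ld^{\mathcal{I}}$ and carry $t=(c_l,c_d,c_r,c_u)$. Then there is $t'=(c_l',c_d',c_r',c_u')$ such that all $r$-successors of $d$ carry $t'$, and: - (i) $t,t'$ are H-compatible; - (ii) if $c_d=\text{white}$ then ($c_r\neq\text{white}$ iff $c_d'=\text{white}$); - (iii) if $c_u=\text{white}$ then $c_u'=\text{white}$. (SLen) There is a unique positive integer $N$ such that all $r$-paths of positive length from $ld^{\mathcal{I}}$ to $rd^{\mathcal{I}}$ have length $N-1$. Moreover, $rd^{\mathcal{I}}$ is the only element $r^{N-1}$-reachable from $ld^{\mathcal{I}}$. (SVerti) Let $d$ be $r^*$-reachable from $ld^{\mathcal{I}}$ and carry a tile $t$ that is not up-border, and let $N$ be as in (SLen). Then there is $t'\in\mathrm{T}$ such that: - all elements $r^N$-reachable from $d$ carry $t'$; - $t,t'$ are V-compatible; - $t$ is left-border (resp. right-border) iff $t'$ is. -}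

module Defs where

open import Data.Nat using (ℕ; zero; suc; _+_; _∸_; _≤_; _<_)
open import Data.Fin using (Fin)
open import Data.Fin.Properties using (_≟_)
open import Data.Bool using (Bool; true; false; if_then_else_)
open import Data.Product using (Σ; _×_; _,_; ∃)
open import Data.Sum using (_⊎_)
open import Relation.Nullary using (¬_; does)
open import Relation.Binary.PropositionalEquality using (_≡_; _≢_)
open import Function.Bundles using (_⇔_)

-- Domino tiling systems
-- Col is the finite set Fin k; T ⊆ Col⁴ is a decidable subset (Bool-valued).

Tile : ℕ → Set
Tile k = Fin k × Fin k × Fin k × Fin k

record DTS : Set where
  field
    k     : ℕ
    T     : Tile k → Bool
    white : Fin k

module _ (D : DTS) where
  open DTS D

  InT : Tile k → Set
  InT t = T t ≡ true

  cl cd cr cu : Tile k → Fin k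
  cl (a , b , c , d) = a
  cd (a , b , c , d) = b
  cr (a , b , c , d) = c
  cu (a , b , c , d) = d

  LeftB DownB RightB UpB : Tile k → Set
  LeftB  t = cl t ≡ white
  DownB  t = cd t ≡ white
  RightB t = cr t ≡ white
  UpB    t = cu t ≡ white

  isW : Fin k → ℕ
  isW c = if does (c ≟ white) then 1 else 0

  whiteCount : Tile k → ℕ
  whiteCount t = isW (cl t) + isW (cd t) + isW (cr t) + isW (cu t)

  AtMostTwoWhite : Set
  AtMostTwoWhite = ∀ t → InT t → whiteCount t ≤ 2

  HCompat VCompat : Tile k → Tile k → Set
  HCompat t t' = cr t ≡ cl t'
  VCompat t t' = cu t ≡ cd t'

  -- D covers Z_n × Z_m; ξ is given on ℕ × ℕ, only its values on
  -- {0..n-1} × {0..m-1} matter.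
  Covers : ℕ → ℕ → Set
  Covers n m = Σ (ℕ → ℕ → Tile k) λ ξ →
      (∀ x y → x < n → y < m →
          InT (ξ x y)
        × ((x ≡ 0) ⇔ LeftB (ξ x y))
        × ((suc x ≡ n) ⇔ RightB (ξ x y))
        × ((y ≡ 0) ⇔ DownB (ξ x y))
        × ((suc y ≡ m) ⇔ UpB (ξ x y)))
    × (∀ x y → suc x < n → y < m → HCompat (ξ x y) (ξ (suc x) y))
    × (∀ x y → x < n → suc y < m → VCompat (ξ x y) (ξ x (suc y)))

  Solvable : Set
  Solvable = Σ ℕ λ n → Σ ℕ λ m → 1 ≤ n × 1 ≤ m × Covers n m

record Interp (D : DTS) : Set₁ where
  field
    Δ  : Set
    r  : Δ → Δ → Set
    C  : Tile (DTS.k D) → Δ → Set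
    ld rd lu ru : Δ

module _ {D : DTS} (I : Interp D) where
  open DTS D
  open Interp I

  IsPath : (ℕ → Δ) → ℕ → Set
  IsPath ρ ℓ = ∀ j → j < ℓ → r (ρ j) (ρ (suc j))

  Reach : ℕ → Δ → Δ → Set
  Reach ℓ d e = Σ (ℕ → Δ) λ ρ → IsPath ρ ℓ × ρ 0 ≡ d × ρ ℓ ≡ e

  ReachPlus ReachStar : Δ → Δ → Set
  ReachPlus d e = Σ ℕ λ ℓ → 1 ≤ ℓ × Reach ℓ d e
  ReachStar d e = Σ ℕ λ ℓ → Reach ℓ d e

  Carries : Δ → Tile k → Set
  Carries d t = InT D t × C t d

  SPath : Set
  SPath = Σ (ℕ → Δ) λ ρ → Σ ℕ λ kk → Σ ℕ λ i → Σ ℕ λ j →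
    IsPath ρ kk × 0 < i × i < j × j < kk ×
    ρ 0 ≡ ld × ρ i ≡ rd × ρ j ≡ lu × ρ kk ≡ ru

  SNoLoop : Set
  SNoLoop = ¬ ReachPlus ld ld × ¬ ReachPlus rd rd
          × ¬ ReachPlus lu lu × ¬ ReachPlus ru ru

  SUniqTil : Set
  SUniqTil = ∀ d → ReachStar ld d →
    Σ (Tile k) λ t → Carries d t × (∀ t' → Carries d t' → t' ≡ t)

  SSpecTil : Set
  SSpecTil =
      (∀ d → ReachStar ld d →
        (Σ (Tile k) λ t → Carries d t × whiteCount D t ≡ 2)
          ⇔ (d ≡ ld ⊎ d ≡ rd ⊎ d ≡ lu ⊎ d ≡ ru))
    × (Σ (Tile k) λ t → Carries ld t × LeftB D t × DownB D t)
    × (Σ (Tile k) λ t → Carries rd t × RightB D t × DownB D t)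
    × (Σ (Tile k) λ t → Carries lu t × LeftB D t × UpB D t)
    × (Σ (Tile k) λ t → Carries ru t × RightB D t × UpB D t)

  SHori : Set
  SHori = ∀ d → ReachStar ld d → d ≢ ru → ∀ t → Carries d t →
    Σ (Tile k) λ t' → InT D t'
      × (∀ e → r d e → Carries e t')
      × HCompat D t t'
      × (DownB D t → ((¬ RightB D t) ⇔ DownB D t'))
      × (UpB D t → UpB D t')

  LenProp : ℕ → Set
  LenProp N = 1 ≤ N × (∀ ℓ → 1 ≤ ℓ → Reach ℓ ld rd → ℓ ≡ N ∸ 1)

  SLen : Set
  SLen = Σ ℕ λ N → LenProp N
    × (∀ N' → LenProp N' → N' ≡ N)
    × Reach (N ∸ 1) ld rd
    × (∀ e → Reach (N ∸ 1) ld e → e ≡ rd)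

  SVerti : Set
  SVerti = ∀ N → LenProp N → ∀ d → ReachStar ld d → ∀ t → Carries d t →
    ¬ UpB D t →
    Σ (Tile k) λ t' → InT D t'
      × (∀ e → Reach N d e → Carries e t')
      × VCompat D t t'
      × (LeftB D t ⇔ LeftB D t')
      × (RightB D t ⇔ RightB D t')

  IsSnake : Set
  IsSnake = SPath × SNoLoop × SUniqTil × SSpecTil × SHori × SLen × SVerti

{-# OPTIONS --safe #-}
module Submission where

open import Defs
open import Data.Product using (Σ; ∃-syntax; _×_; _,_; proj₁; proj₂)
open import Data.Nat
open import Data.Nat.Properties
open import Data.Nat.DivMod using (_/_; _%_; m≡m%n+[m/n]*n; m%n<n)
open import Data.Fin using (Fin)
import Data.Fin.Properties as Fin
open import Data.Sum using (_⊎_; inj₁; inj₂)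
open import Data.Empty using (⊥-elim)
open import Relation.Nullary using (¬_; yes; no; contradiction)
open import Relation.Unary using (Decidable)
open import Relation.Binary.PropositionalEquality
open import Function.Base using (_∘_)
open import Function.Bundles using (_⇔_; mk⇔; Equivalence)
open import Function.Properties.Equivalence using () renaming (trans to ⇔-trans)

open Equivalence using (to; from)

-- Walk along the r-path of (SPath) from ld through rd and lu to ru and read off the
-- unique tile at each position.  By (SLen) rd sits at position N - 1, and by (SHori)
-- positions 0, …, N - 1 form a bottom row: all down-border, right-border only at the
-- end, because a down- and right-border tile has two white sides and hence must be rd.
-- Before the first up-border position, (SVerti) copies left and right borders N steps
-- ahead, so the path is cut into rows of width N with borders exactly at the ends.
-- The first up-border position falls in some row Y; being up-border persists along the
-- path, so the right end of row Y is right- and up-border, hence is ru, the end of the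
-- path; and lu, being up- and left-border, is the start of row Y.  Read row by row, the
-- path covers ℤ_N × ℤ_{Y+1}.

module _ {P : ℕ → Set} (P? : Decidable P) where

  private
    minimal-or-none : ∀ m → (∃[ q ] P q × (∀ {p} → p < q → ¬ P p))
                          ⊎ (∀ {p} → p < m → ¬ P p)
    minimal-or-none zero = inj₂ λ ()
    minimal-or-none (suc m) with minimal-or-none m | P? m
    ... | inj₁ found | _      = inj₁ found
    ... | inj₂ none  | yes Pm = inj₁ (m , Pm , none)
    ... | inj₂ none  | no ¬Pm = inj₂ below
      where
        below : ∀ {p} → p < suc m → ¬ P p
        below p<1+m with m≤n⇒m<n∨m≡n (s≤s⁻¹ p<1+m)
        ... | inj₁ p<m  = none p<m
        ... | inj₂ refl = ¬Pm

  minimal-witness : ∀ {m} → P m → ∃[ q ] P q × (∀ {p} → p < q → ¬ P p)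
  minimal-witness {m} Pm with minimal-or-none (suc m)
  ... | inj₁ found = found
  ... | inj₂ none  = contradiction Pm (none (n<1+n m))

interval-induction : ∀ {P : ℕ → Set} {a b} → P a →
                     (∀ {p} → a ≤ p → p < b → P p → P (suc p)) →
                     ∀ {p} → a ≤ p → p ≤ b → P p
interval-induction Pa step {p} a≤p p≤b with m≤n⇒m<n∨m≡n a≤p
... | inj₂ refl = Pa
interval-induction Pa step {suc p} _ p<b | inj₁ a<1+p =
  step (s≤s⁻¹ a<1+p) p<b (interval-induction Pa step (s≤s⁻¹ a<1+p) (<⇒≤ p<b))

module _ (D : DTS) where
  open DTS D

  private variable
    c : Fin k

  white⇒1≤isW : c ≡ white → 1 ≤ isW D c
  white⇒1≤isW refl with white Fin.≟ white
  ... | yes _   = ≤-refl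
  ... | no w≢w = contradiction refl w≢w

  LDR⇒3≤whiteCount : ∀ t → LeftB D t → DownB D t → RightB D t → 3 ≤ whiteCount D t
  LDR⇒3≤whiteCount (_ , _ , _ , u) l d r =
    +-mono-≤ (+-mono-≤ (+-mono-≤ (white⇒1≤isW l) (white⇒1≤isW d)) (white⇒1≤isW r)) (z≤n {isW D u})

  DRU⇒3≤whiteCount : ∀ t → DownB D t → RightB D t → UpB D t → 3 ≤ whiteCount D t
  DRU⇒3≤whiteCount (a , _ , _ , _) d r u =
    +-mono-≤ (+-mono-≤ (+-mono-≤ (z≤n {isW D a}) (white⇒1≤isW d)) (white⇒1≤isW r)) (white⇒1≤isW u)

  LRU⇒3≤whiteCount : ∀ t → LeftB D t → RightB D t → UpB D t → 3 ≤ whiteCount D t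
  LRU⇒3≤whiteCount (_ , b , _ , _) l r u =
    +-mono-≤ (+-mono-≤ (+-mono-≤ (white⇒1≤isW l) (z≤n {isW D b})) (white⇒1≤isW r)) (white⇒1≤isW u)

  DR⇒2≤whiteCount : ∀ t → DownB D t → RightB D t → 2 ≤ whiteCount D t
  DR⇒2≤whiteCount (a , _ , _ , u) d r =
    +-mono-≤ (+-mono-≤ (+-mono-≤ (z≤n {isW D a}) (white⇒1≤isW d)) (white⇒1≤isW r)) (z≤n {isW D u})

  RU⇒2≤whiteCount : ∀ t → RightB D t → UpB D t → 2 ≤ whiteCount D t
  RU⇒2≤whiteCount (a , b , _ , _) r u =
    +-mono-≤ (+-mono-≤ (+-mono-≤ (z≤n {isW D a}) (z≤n {isW D b})) (white⇒1≤isW r)) (white⇒1≤isW u)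

module _ {D : DTS} (atMostTwo : AtMostTwoWhite D) {I : Interp D} where
  open DTS D
  open Interp I

  private variable
    p x y : ℕ
    t : Tile k

  module SnakeRows
    (ρ : ℕ → Δ) (kk i j : ℕ) (path : IsPath I ρ kk)
    (0<i : 0 < i) (i<j : i < j) (j<kk : j < kk)
    (ρ0 : ρ 0 ≡ ld) (ρi : ρ i ≡ rd) (ρj : ρ j ≡ lu) (ρk : ρ kk ≡ ru)
    (no-ru-loop : ¬ ReachPlus I ru ru)
    (uniq : SUniqTil I)
    (two-white⇔corner : ∀ d → ReachStar I ld d →
       (Σ (Tile k) λ t → Carries I d t × whiteCount D t ≡ 2)
       ⇔ (d ≡ ld ⊎ d ≡ rd ⊎ d ≡ lu ⊎ d ≡ ru))
    (ld-corner : Σ (Tile k) λ t → Carries I ld t × LeftB D t × DownB D t)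
    (rd-corner : Σ (Tile k) λ t → Carries I rd t × RightB D t × DownB D t)
    (lu-corner : Σ (Tile k) λ t → Carries I lu t × LeftB D t × UpB D t)
    (ru-corner : Σ (Tile k) λ t → Carries I ru t × RightB D t × UpB D t)
    (hori : SHori I)
    (N : ℕ) (lenN : LenProp I N)
    (verti : SVerti I)
    where

    prefix : p ≤ kk → Reach I p ld (ρ p)
    prefix p≤kk = ρ , (λ q q<p → path q (<-≤-trans q<p p≤kk)) , ρ0 , refl

    on-path : p ≤ kk → ReachStar I ld (ρ p)
    on-path p≤kk = _ , prefix p≤kk

    segment : ∀ a ℓ → ℓ + a ≤ kk → Reach I ℓ (ρ a) (ρ (ℓ + a))
    segment a ℓ ℓ+a≤kk = (λ q → ρ (q + a)) , step , refl , refl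
      where
        step : IsPath I (λ q → ρ (q + a)) ℓ
        step q q<ℓ = path (q + a) (≤-trans (+-monoˡ-≤ a q<ℓ) ℓ+a≤kk)

    tile : ℕ → Tile k
    tile p with p ≤? kk
    ... | yes p≤kk = proj₁ (uniq (ρ p) (on-path p≤kk))
    ... | no _     = white , white , white , white

    tile-carried : p ≤ kk → Carries I (ρ p) (tile p)
    tile-carried {p} p≤kk with p ≤? kk
    ... | yes p≤kk′ = proj₁ (proj₂ (uniq (ρ p) (on-path p≤kk′)))
    ... | no p≰kk   = contradiction p≤kk p≰kk

    tile-unique : p ≤ kk → Carries I (ρ p) t → tile p ≡ t
    tile-unique {p} p≤kk c with p ≤? kk
    ... | yes p≤kk′ = sym (proj₂ (proj₂ (uniq (ρ p) (on-path p≤kk′))) _ c)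
    ... | no p≰kk   = contradiction p≤kk p≰kk

    tile∈T : p ≤ kk → InT D (tile p)
    tile∈T p≤kk = proj₁ (tile-carried p≤kk)

    ¬3≤whiteCount : p ≤ kk → ¬ (3 ≤ whiteCount D (tile p))
    ¬3≤whiteCount p≤kk 3≤w = n≮n 2 (≤-trans 3≤w (atMostTwo _ (tile∈T p≤kk)))

    carried-sides : ∀ {P : Tile k → Set} {e} → (Σ (Tile k) λ t → Carries I e t × P t) →
                    ρ p ≡ e → p ≤ kk → P (tile p)
    carried-sides {P = P} (t , c , Pt) refl p≤kk = subst P (sym (tile-unique p≤kk c)) Pt

    ld-sides : ρ p ≡ ld → p ≤ kk → LeftB D (tile p) × DownB D (tile p)
    ld-sides = carried-sides ld-corner

    rd-sides : ρ p ≡ rd → p ≤ kk → RightB D (tile p) × DownB D (tile p)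
    rd-sides = carried-sides rd-corner

    lu-sides : ρ p ≡ lu → p ≤ kk → LeftB D (tile p) × UpB D (tile p)
    lu-sides = carried-sides lu-corner

    ru-sides : ρ p ≡ ru → p ≤ kk → RightB D (tile p) × UpB D (tile p)
    ru-sides = carried-sides ru-corner

    two-white⇒corner : p ≤ kk → 2 ≤ whiteCount D (tile p) →
                       ρ p ≡ ld ⊎ ρ p ≡ rd ⊎ ρ p ≡ lu ⊎ ρ p ≡ ru
    two-white⇒corner {p} p≤kk 2≤w = to (two-white⇔corner (ρ p) (on-path p≤kk))
      (tile p , tile-carried p≤kk , ≤-antisym (atMostTwo _ (tile∈T p≤kk)) 2≤w)

    down-right⇒rd : p ≤ kk → DownB D (tile p) → RightB D (tile p) → ρ p ≡ rd
    down-right⇒rd {p} p≤kk d r with two-white⇒corner p≤kk (DR⇒2≤whiteCount D (tile p) d r)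
    ... | inj₁ ≡ld =
      ⊥-elim (¬3≤whiteCount p≤kk (LDR⇒3≤whiteCount D (tile p) (proj₁ (ld-sides ≡ld p≤kk)) d r))
    ... | inj₂ (inj₁ ≡rd) = ≡rd
    ... | inj₂ (inj₂ (inj₁ ≡lu)) =
      ⊥-elim (¬3≤whiteCount p≤kk (LDR⇒3≤whiteCount D (tile p) (proj₁ (lu-sides ≡lu p≤kk)) d r))
    ... | inj₂ (inj₂ (inj₂ ≡ru)) =
      ⊥-elim (¬3≤whiteCount p≤kk (DRU⇒3≤whiteCount D (tile p) d r (proj₂ (ru-sides ≡ru p≤kk))))

    right-up⇒ru : p ≤ kk → RightB D (tile p) → UpB D (tile p) → ρ p ≡ ru
    right-up⇒ru {p} p≤kk r u with two-white⇒corner p≤kk (RU⇒2≤whiteCount D (tile p) r u)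
    ... | inj₁ ≡ld = let (l , d) = ld-sides ≡ld p≤kk in
      ⊥-elim (¬3≤whiteCount p≤kk (LDR⇒3≤whiteCount D (tile p) l d r))
    ... | inj₂ (inj₁ ≡rd) =
      ⊥-elim (¬3≤whiteCount p≤kk (DRU⇒3≤whiteCount D (tile p) (proj₂ (rd-sides ≡rd p≤kk)) r u))
    ... | inj₂ (inj₂ (inj₁ ≡lu)) =
      ⊥-elim (¬3≤whiteCount p≤kk (LRU⇒3≤whiteCount D (tile p) (proj₁ (lu-sides ≡lu p≤kk)) r u))
    ... | inj₂ (inj₂ (inj₂ ≡ru)) = ≡ru

    rd-length : p ≤ kk → 1 ≤ p → ρ p ≡ rd → p ≡ N ∸ 1
    rd-length p≤kk 1≤p ρp≡rd = proj₂ lenN _ 1≤p (subst (Reach I _ ld) ρp≡rd (prefix p≤kk))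

    i≤kk : i ≤ kk
    i≤kk = <⇒≤ (<-trans i<j j<kk)

    rd-position : p ≤ kk → ρ p ≡ rd → p ≡ i
    rd-position {zero} _ ρ0≡rd = let (r , d) = rd-sides ρ0≡rd z≤n in
      ⊥-elim (¬3≤whiteCount z≤n (LDR⇒3≤whiteCount D (tile 0) (proj₁ (ld-sides ρ0 z≤n)) d r))
    rd-position {suc p} p≤kk ρp≡rd =
      trans (rd-length p≤kk z<s ρp≡rd) (sym (rd-length i≤kk 0<i ρi))

    ru-position : p ≤ kk → ρ p ≡ ru → p ≡ kk
    ru-position {p} p≤kk ρp≡ru with m≤n⇒m<n∨m≡n p≤kk
    ... | inj₂ p≡kk = p≡kk
    ... | inj₁ p<kk = ⊥-elim (no-ru-loop (kk ∸ p , m<n⇒0<n∸m p<kk ,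
            subst₂ (Reach I (kk ∸ p)) ρp≡ru (trans (cong ρ (m∸n+n≡m p≤kk)) ρk)
                   (segment p (kk ∸ p) (≤-reflexive (m∸n+n≡m p≤kk)))))

    n : ℕ
    n = suc i

    n≡N : n ≡ N
    n≡N = trans (cong suc (rd-length i≤kk 0<i ρi)) (suc-pred N {{>-nonZero (proj₁ lenN)}})

    HStep VStep : Tile k → Tile k → Set
    HStep t t′ = HCompat D t t′ × (DownB D t → ((¬ RightB D t) ⇔ DownB D t′))
               × (UpB D t → UpB D t′)
    VStep t t′ = VCompat D t t′ × (LeftB D t ⇔ LeftB D t′) × (RightB D t ⇔ RightB D t′)

    horizontal : p < kk → HStep (tile p) (tile (suc p))
    horizontal {p} p<kk
      with hori (ρ p) (on-path (<⇒≤ p<kk)) (<⇒≢ p<kk ∘ ru-position (<⇒≤ p<kk))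
                (tile p) (tile-carried (<⇒≤ p<kk))
    ... | _ , _ , next , step rewrite tile-unique p<kk (next _ (path p p<kk)) = step

    vertical : n + p ≤ kk → ¬ UpB D (tile p) → VStep (tile p) (tile (n + p))
    vertical {p} n+p≤kk ¬up
      with verti n (subst (LenProp I) (sym n≡N) lenN) (ρ p) (on-path p≤kk)
                 (tile p) (tile-carried p≤kk) ¬up
      where
        p≤kk : p ≤ kk
        p≤kk = ≤-trans (m≤n+m p n) n+p≤kk
    ... | _ , _ , above , step rewrite tile-unique n+p≤kk (above _ (segment p n n+p≤kk)) = step

    ColumnBorders : ℕ → ℕ → Set
    ColumnBorders x p = (x ≡ 0 ⇔ LeftB D (tile p)) × (suc x ≡ n ⇔ RightB D (tile p))

    row0-not-right : x < i → DownB D (tile x) → ¬ RightB D (tile x)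
    row0-not-right {x} x<i d r = <⇒≢ x<i (rd-position x≤kk (down-right⇒rd x≤kk d r))
      where
        x≤kk : x ≤ kk
        x≤kk = ≤-trans (<⇒≤ x<i) i≤kk

    row0-down : x ≤ i → DownB D (tile x)
    row0-down {zero}  _   = proj₂ (ld-sides ρ0 z≤n)
    row0-down {suc x} x<i =
      to (proj₁ (proj₂ (horizontal (<-≤-trans x<i i≤kk))) down) (row0-not-right x<i down)
      where
        down : DownB D (tile x)
        down = row0-down (<⇒≤ x<i)

    row0-borders : x ≤ i → ColumnBorders x x
    row0-borders {x} x≤i = mk⇔ 0⇒left (left⇒0 x≤i) , mk⇔ end⇒right right⇒end
      where
        0⇒left : x ≡ 0 → LeftB D (tile x)
        0⇒left refl = proj₁ (ld-sides ρ0 z≤n)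
        end⇒right : suc x ≡ n → RightB D (tile x)
        end⇒right refl = proj₁ (rd-sides ρi i≤kk)
        left⇒0 : ∀ {x} → x ≤ i → LeftB D (tile x) → x ≡ 0
        left⇒0 {zero}  _   _ = refl
        left⇒0 {suc x} x<i l = ⊥-elim (row0-not-right x<i (row0-down (<⇒≤ x<i))
                                  (trans (proj₁ (horizontal (<-≤-trans x<i i≤kk))) l))
        right⇒end : RightB D (tile x) → suc x ≡ n
        right⇒end r with m≤n⇒m<n∨m≡n x≤i
        ... | inj₁ x<i = ⊥-elim (row0-not-right x<i (row0-down x≤i) r)
        ... | inj₂ x≡i = cong suc x≡i

    first-up : ∃[ q ] UpB D (tile q) × (∀ {p} → p < q → ¬ UpB D (tile p))
    first-up =
      minimal-witness (λ p → cu D (tile p) Fin.≟ white) {kk} (proj₂ (ru-sides ρk ≤-refl))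

    q : ℕ
    q = proj₁ first-up

    not-up-before-q : p < q → ¬ UpB D (tile p)
    not-up-before-q = proj₂ (proj₂ first-up)

    up⇒q≤ : UpB D (tile p) → q ≤ p
    up⇒q≤ up = ≮⇒≥ λ p<q → not-up-before-q p<q up

    q≤kk : q ≤ kk
    q≤kk = up⇒q≤ (proj₂ (ru-sides ρk ≤-refl))

    up-from-q : q ≤ p → p ≤ kk → UpB D (tile p)
    up-from-q = interval-induction {P = UpB D ∘ tile} (proj₁ (proj₂ first-up))
                                   (λ _ p<kk → proj₂ (proj₂ (horizontal p<kk)))

    pos : ℕ → ℕ → ℕ
    pos y x = y * n + x

    Y : ℕ
    Y = q / n

    q≡pos : q ≡ pos Y (q % n)
    q≡pos = trans (m≡m%n+[m/n]*n q n) (+-comm (q % n) (Y * n))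

    Y*n≤q : Y * n ≤ q
    Y*n≤q = subst (Y * n ≤_) (sym q≡pos) (m≤m+n (Y * n) (q % n))

    pos<q : y < Y → x < n → pos y x < q
    pos<q {y} {x} y<Y x<n = begin-strict
      y * n + x   <⟨ +-monoʳ-< (y * n) x<n ⟩
      y * n + n   ≡⟨ +-comm (y * n) n ⟩
      suc y * n   ≤⟨ *-monoˡ-≤ n y<Y ⟩
      Y * n       ≤⟨ Y*n≤q ⟩
      q           ∎
      where open ≤-Reasoning

    vertical-pos : pos (suc y) x ≤ kk → ¬ UpB D (tile (pos y x)) →
                   VStep (tile (pos y x)) (tile (pos (suc y) x))
    vertical-pos {y} {x} h ¬up =
      subst (VStep (tile (pos y x)) ∘ tile) (sym pos-suc) (vertical (subst (_≤ kk) pos-suc h) ¬up)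
      where
        pos-suc : pos (suc y) x ≡ n + pos y x
        pos-suc = +-assoc n (y * n) x

    grid-borders : y ≤ Y → x < n → pos y x ≤ kk → ColumnBorders x (pos y x)
    grid-borders {zero}      _   x<n _ = row0-borders (s≤s⁻¹ x<n)
    grid-borders {suc y} {x} y<Y x<n h =
      ⇔-trans (proj₁ below) (proj₁ (proj₂ step)) , ⇔-trans (proj₂ below) (proj₂ (proj₂ step))
      where
        below : ColumnBorders x (pos y x)
        below = grid-borders (<⇒≤ y<Y) x<n (<⇒≤ (<-≤-trans (pos<q y<Y x<n) q≤kk))
        step : VStep (tile (pos y x)) (tile (pos (suc y) x))
        step = vertical-pos {y} h (not-up-before-q (pos<q y<Y x<n))

    module _ {p} (Y*n≤p : Y * n ≤ p) (p<end : p < pos Y i) (p≤kk : p ≤ kk) where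
      private
        pos≡p : pos Y (p ∸ Y * n) ≡ p
        pos≡p = m+[n∸m]≡n Y*n≤p

        offset<i : p ∸ Y * n < i
        offset<i = +-cancelˡ-< (Y * n) (p ∸ Y * n) i (subst (_< pos Y i) (sym pos≡p) p<end)

        borders : ColumnBorders (p ∸ Y * n) p
        borders = subst (ColumnBorders (p ∸ Y * n)) pos≡p
          (grid-borders ≤-refl (m<n⇒m<1+n offset<i) (subst (_≤ kk) (sym pos≡p) p≤kk))

      last-row-not-right : ¬ RightB D (tile p)
      last-row-not-right r = <⇒≢ offset<i (suc-injective (from (proj₂ borders) r))

      last-row-left : LeftB D (tile p) → p ≡ pos Y 0
      last-row-left l = trans (sym pos≡p) (cong (pos Y) (from (proj₁ borders) l))

    Y*n≤kk : Y * n ≤ kk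
    Y*n≤kk = ≤-trans Y*n≤q q≤kk

    last-row-end≤kk : pos Y i ≤ kk
    last-row-end≤kk = ≮⇒≥ λ kk<end →
      last-row-not-right Y*n≤kk kk<end ≤-refl (proj₁ (ru-sides ρk ≤-refl))

    last-row-end≡kk : pos Y i ≡ kk
    last-row-end≡kk = ru-position last-row-end≤kk (right-up⇒ru last-row-end≤kk right up)
      where
        right : RightB D (tile (pos Y i))
        right = to (proj₂ (grid-borders ≤-refl ≤-refl last-row-end≤kk)) refl
        up : UpB D (tile (pos Y i))
        up = up-from-q (subst (_≤ pos Y i) (sym q≡pos) (+-monoʳ-≤ (Y * n) (s≤s⁻¹ (m%n<n q n))))
                       last-row-end≤kk

    q≤last-row-start : q ≤ pos Y 0
    q≤last-row-start =
      subst (q ≤_) (last-row-left Y*n≤j j<end j≤kk (proj₁ (lu-sides ρj j≤kk))) q≤j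
      where
        j≤kk : j ≤ kk
        j≤kk = <⇒≤ j<kk
        q≤j : q ≤ j
        q≤j = up⇒q≤ (proj₂ (lu-sides ρj j≤kk))
        Y*n≤j : Y * n ≤ j
        Y*n≤j = ≤-trans Y*n≤q q≤j
        j<end : j < pos Y i
        j<end = subst (j <_) (sym last-row-end≡kk) j<kk

    pos≤kk : y ≤ Y → x < n → pos y x ≤ kk
    pos≤kk y≤Y x<n =
      ≤-trans (+-mono-≤ (*-monoˡ-≤ n y≤Y) (s≤s⁻¹ x<n)) (≤-reflexive last-row-end≡kk)

    ξ : ℕ → ℕ → Tile k
    ξ x y = tile (pos y x)

    ξ-down : y ≤ Y → x < n → (y ≡ 0 ⇔ DownB D (ξ x y))
    ξ-down {zero}      _   x<n = mk⇔ (λ _ → row0-down (s≤s⁻¹ x<n)) (λ _ → refl)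
    ξ-down {suc y} {x} y<Y x<n = mk⇔ (λ ()) λ down →
      ⊥-elim (¬up (trans (proj₁ (vertical-pos {y} (pos≤kk y<Y x<n) ¬up)) down))
      where
        ¬up : ¬ UpB D (tile (pos y x))
        ¬up = not-up-before-q (pos<q y<Y x<n)

    ξ-up : y ≤ Y → x < n → (suc y ≡ suc Y ⇔ UpB D (ξ x y))
    ξ-up {x = x} y≤Y x<n with m≤n⇒m<n∨m≡n y≤Y
    ... | inj₁ y<Y  = mk⇔ (λ 1+y≡1+Y → ⊥-elim (<⇒≢ y<Y (suc-injective 1+y≡1+Y)))
                          (λ up → ⊥-elim (not-up-before-q (pos<q y<Y x<n) up))
    ... | inj₂ refl = mk⇔ (λ _ → up-from-q q≤pos (pos≤kk ≤-refl x<n)) (λ _ → refl)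
      where
        q≤pos : q ≤ pos Y x
        q≤pos = ≤-trans q≤last-row-start (+-monoʳ-≤ (Y * n) z≤n)

    ξ-cell : ∀ x y → x < n → y < suc Y →
             InT D (ξ x y)
           × ((x ≡ 0) ⇔ LeftB D (ξ x y)) × ((suc x ≡ n) ⇔ RightB D (ξ x y))
           × ((y ≡ 0) ⇔ DownB D (ξ x y)) × ((suc y ≡ suc Y) ⇔ UpB D (ξ x y))
    ξ-cell x y x<n y<1+Y =
      tile∈T (pos≤kk y≤Y x<n) , proj₁ borders , proj₂ borders , ξ-down y≤Y x<n , ξ-up y≤Y x<n
      where
        y≤Y : y ≤ Y
        y≤Y = s≤s⁻¹ y<1+Y
        borders : ColumnBorders x (pos y x)
        borders = grid-borders y≤Y x<n (pos≤kk y≤Y x<n)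

    ξ-hcompat : ∀ x y → suc x < n → y < suc Y → HCompat D (ξ x y) (ξ (suc x) y)
    ξ-hcompat x y 1+x<n y<1+Y = subst (HCompat D (ξ x y) ∘ tile) (sym (+-suc (y * n) x))
      (proj₁ (horizontal (subst (_≤ kk) (+-suc (y * n) x) (pos≤kk (s≤s⁻¹ y<1+Y) 1+x<n))))

    ξ-vcompat : ∀ x y → x < n → suc y < suc Y → VCompat D (ξ x y) (ξ x (suc y))
    ξ-vcompat x y x<n 1+y<1+Y =
      proj₁ (vertical-pos {y} (pos≤kk y<Y x<n) (not-up-before-q (pos<q y<Y x<n)))
      where
        y<Y : y < Y
        y<Y = s≤s⁻¹ 1+y<1+Y

    solvable : Solvable D
    solvable = n , suc Y , s≤s z≤n , s≤s z≤n , ξ , ξ-cell , ξ-hcompat , ξ-vcompat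

lemma4p4 : (D : DTS) → AtMostTwoWhite D → Σ (Interp D) IsSnake → Solvable D
lemma4p4 D atMostTwo
  (I , (ρ , kk , i , j , path , 0<i , i<j , j<kk , ρ0 , ρi , ρj , ρk) , (_ , _ , _ , no-ru-loop) ,
       uniq , (two-white⇔corner , ld-corner , rd-corner , lu-corner , ru-corner) , hori ,
       (N , lenN , _) , verti) =
  SnakeRows.solvable atMostTwo ρ kk i j path 0<i i<j j<kk ρ0 ρi ρj ρk no-ru-loop uniq
    two-white⇔corner ld-corner rd-corner lu-corner ru-corner hori N lenN verti
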